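{- Let $N,a,b$ be positive integers with $a<b\le N$, $N$ and $b-a$ even, and let $s$ be a number. Let $A=(A_{i,j})_{1\le i,j\le N}$ be a skew-symmetric matrix whose entries are polynomials in $x$, such that every entry in rows $a+1,a+2,\dots,b$ (hence also in the corresponding columns) is divisible by $x+s$. Then $$\left(\frac{1}{(x+s)^{(b-a)/2}}\operatorname{Pf}A\right)\bigg|_{x=-s}=\operatorname{Pf}\widetilde A\cdot\operatorname{Pf}S,$$ where $\widetilde A$ is obtained from $A$ by deleting rows and columns $a+1,\dots,b$ and then specializing $x=-s$, and $S=\left(\left(\frac{1}{x+s}A_{i,j}\right)\big|_{x=-s}\right)_{a+1\le i,j\le b}$.
   Context: The Pfaffian of a skew-symmetric $2m\times2m$ matrix $B$ (indexed by an ordered set of size $2m$) is $\sum_\pi\operatorname{sgn}\pi\prod_{i<j\text{ matched in }\pi}B_{i,j}$, the sum over perfect matchings $\pi$ of the index set, with $\operatorname{sgn}\pi=(-1)^{\mathrm{cr}(\pi)}$, $\mathrm{cr}(\pi)$ being the number of quadruples $i<j<k<l$ with $i$ matched to $k$ and $j$ matched to $l$. -}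

module Defs where

open import Level using (Level)
open import Algebra.Bundles using (CommutativeRing)
open import Data.Nat as ℕ using (ℕ; zero; suc; _<ᵇ_)
open import Data.Nat.Properties using (_≤?_; _<?_)
open import Data.Bool using (Bool; true; false; if_then_else_; _∧_)
open import Data.Fin using (Fin; toℕ)
open import Data.List using (List; []; _∷_; [_]; map; concatMap; length; foldr; filter; allFin)
open import Data.Product using (_×_; _,_; ∃)
open import Relation.Nullary using (Dec; yes; no)
open import Relation.Nullary.Decidable using (_×-dec_)

picks : ∀ {a} {α : Set a} → List α → List (α × List α)
picks [] = []
picks (y ∷ ys) = (y , ys) ∷ map (λ { (z , zs) → (z , y ∷ zs) }) (picks ys)

-- perfect matchings of a list, each matching a list of pairs (x , y)
-- with x before y in the list; the natural-number argument is fuel,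
-- always instantiated with the length of the list (which suffices).
matchingsF : ∀ {a} {α : Set a} → ℕ → List α → List (List (α × α))
matchingsF _ [] = [ [] ]
matchingsF zero (_ ∷ _) = []
matchingsF (suc n) (x ∷ xs) =
  concatMap (λ { (y , rest) → map ((x , y) ∷_) (matchingsF n rest) }) (picks xs)

matchings : ∀ {a} {α : Set a} → List α → List (List (α × α))
matchings xs = matchingsF (length xs) xs

crossings : ∀ {N} → List (Fin N × Fin N) → ℕ
crossings m = foldr ℕ._+_ 0
  (concatMap (λ { (i , k) → map (λ { (j , l) →
     if (toℕ i <ᵇ toℕ j) ∧ (toℕ j <ᵇ toℕ k) ∧ (toℕ k <ᵇ toℕ l) then 1 else 0 }) m }) m)

isEven : ℕ → Bool
isEven zero = true
isEven (suc n) = if isEven n then false else true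

module OverRing {c ℓ : Level} (R : CommutativeRing c ℓ) where
  open CommutativeRing R

  -- Pfaffian of the matrix B restricted to the index set I (a list of
  -- indices in increasing order): sum over perfect matchings π of I of
  -- (-1)^cr(π) * prod_{pairs (i,j) of π} B i j.
  Pf : ∀ {N} → List (Fin N) → (Fin N → Fin N → Carrier) → Carrier
  Pf I B = foldr _+_ 0#
    (map (λ π → sgn π * foldr _*_ 1# (map (λ { (i , j) → B i j }) π)) (matchings I))
    where
    sgn : List _ → Carrier
    sgn π = if isEven (crossings π) then 1# else - 1#

  -- Univariate polynomials in x over R: coefficient lists, lowest degree first.
  Poly : Set c
  Poly = List Carrier

  coeff : Poly → ℕ → Carrier
  coeff [] _ = 0#
  coeff (p ∷ ps) zero = p
  coeff (p ∷ ps) (suc n) = coeff ps n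

  infix 4 _≈P_
  _≈P_ : Poly → Poly → Set ℓ
  p ≈P q = ∀ n → coeff p n ≈ coeff q n

  infixl 6 _+P_
  _+P_ : Poly → Poly → Poly
  [] +P q = q
  (p ∷ ps) +P [] = p ∷ ps
  (p ∷ ps) +P (q ∷ qs) = (p + q) ∷ (ps +P qs)

  -P_ : Poly → Poly
  -P p = map -_ p

  0P 1P : Poly
  0P = []
  1P = 1# ∷ []

  _·P_ : Carrier → Poly → Poly
  r ·P p = map (r *_) p

  infixl 7 _*P_
  _*P_ : Poly → Poly → Poly
  [] *P q = []
  (p ∷ ps) *P q = (p ·P q) +P (0# ∷ (ps *P q))

  _^P_ : Poly → ℕ → Poly
  p ^P zero = 1P
  p ^P suc n = p *P (p ^P n)

  xPlus : Carrier → Poly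
  xPlus s = s ∷ 1# ∷ []

  eval : Poly → Carrier → Carrier
  eval [] t = 0#
  eval (p ∷ ps) t = p + t * eval ps t

  PfP : ∀ {N} → List (Fin N) → (Fin N → Fin N → Poly) → Poly
  PfP I B = foldr _+P_ 0P
    (map (λ π → sgn π *P foldr _*P_ 1P (map (λ { (i , j) → B i j }) π)) (matchings I))
    where
    sgn : List _ → Poly
    sgn π = if isEven (crossings π) then 1P else -P 1P

-- index sets (0-based: Fin index i corresponds to row/column i+1)

-- rows a+1,...,b  (1-based)  ↔  a ≤ toℕ i < b
InBlock : ∀ {N} → ℕ → ℕ → Fin N → Set
InBlock a b i = a ℕ.≤ toℕ i × toℕ i ℕ.< b

inBlock? : ∀ {N} (a b : ℕ) (i : Fin N) → Dec (InBlock a b i)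
inBlock? a b i = (a ≤? toℕ i) ×-dec (suc (toℕ i) ≤? b)

blockIdx : (N a b : ℕ) → List (Fin N)
blockIdx N a b = filter (inBlock? a b) (allFin N)

outsideIdx : (N a b : ℕ) → List (Fin N)
outsideIdx N a b = filter (λ i → Relation.Nullary.¬? (inBlock? a b i)) (allFin N)
  where import Relation.Nullary

module Submission where

-- Let B = {a+1,…,b}, C = b − a and k = C / 2.  Skew-symmetry and the
-- hypothesis give A_ij = (x+s)^e · B_ij with e = 1 if the pair (i , j)
-- meets B (entry-factor).  For a perfect matching π let E(π) be the number
-- of its pairs meeting B and m(π) the number of mixed pairs (one end in B);
-- counting points of B gives C + m(π) = 2 E(π) (block-points).  So
-- E(π) ≥ k and Pf A = (x+s)^k · Q with Q = Σ_π sgn π (x+s)^(E(π)−k) Π B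
-- (divisibility).  At x = −s the factor (x+s)^(E−k) becomes 0^m(π), which
-- kills every matching with a mixed pair; such a sum splits into a double
-- sum over matchings σ of the outside and τ of B (split-sum), and since B
-- is an interval σ and τ do not cross, so sgn(σ ++ τ) = sgn σ · sgn τ and
-- Q(−s) = Pf Ã · Pf S (evaluation).

open import Defs

open import Level using (Level; _⊔_)
open import Algebra.Bundles using (CommutativeRing; CommutativeMonoid)
open import Data.Nat as ℕ using (ℕ; zero; suc; _≤_; _<_; _∸_; _/_; s≤s)
import Data.Nat.Properties as ℕP
import Data.Nat.DivMod as ℕD
open import Data.Nat.Divisibility using (_∣_)
open import Data.Bool using (Bool; true; false; if_then_else_; _∧_; not)
open import Data.Fin using (Fin; toℕ)
open import Data.List using (List; []; _∷_; [_]; map; concat; concatMap; length; foldr; filter; allFin; _++_; tabulate; applyUpTo; upTo)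
import Data.List.Properties as ListP
open import Data.List.Relation.Unary.All as All using (All; []; _∷_)
import Data.List.Relation.Unary.All.Properties as AllP
open import Data.List.Relation.Binary.Permutation.Propositional as Perm using (_↭_; ↭-sym; ↭-trans)
import Data.List.Relation.Binary.Permutation.Propositional.Properties as PermP
open import Data.Product using (_×_; Σ; _,_; proj₁; proj₂)
open import Data.Sum using (_⊎_; inj₁; inj₂)
open import Data.Empty using (⊥; ⊥-elim)
open import Data.Unit using (tt)
open import Function using (_∘_)
open import Relation.Binary.PropositionalEquality as ≡ using (_≡_)
open import Relation.Nullary using (¬_; Dec; yes; no; does; ¬?)
open import Relation.Nullary.Decidable using (decidable-stable; dec-true; dec-false; _×-dec_)
open import Relation.Unary using (Pred; Decidable)

module Sums {c ℓ} (M : CommutativeMonoid c ℓ) where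
  open CommutativeMonoid M renaming (Carrier to C)
  open import Algebra.Properties.CommutativeSemigroup commutativeSemigroup using (interchange)

  sumM : ∀ {b} {β : Set b} → (β → C) → List β → C
  sumM f l = foldr _∙_ ε (map f l)

  sum-cong-All : ∀ {b} {β : Set b} {f g : β → C} {l : List β} →
    All (λ x → f x ≈ g x) l → sumM f l ≈ sumM g l
  sum-cong-All [] = refl
  sum-cong-All (e ∷ es) = ∙-cong e (sum-cong-All es)

  sum-cong : ∀ {b} {β : Set b} {f g : β → C} (l : List β) →
    (∀ x → f x ≈ g x) → sumM f l ≈ sumM g l
  sum-cong l e = sum-cong-All (All.universal e l)

  sum-zero-All : ∀ {b} {β : Set b} {f : β → C} {l : List β} →
    All (λ x → f x ≈ ε) l → sumM f l ≈ ε
  sum-zero-All [] = refl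
  sum-zero-All (e ∷ es) = trans (∙-cong e (sum-zero-All es)) (identityˡ ε)

  sum-map : ∀ {b d} {β : Set b} {δ : Set d} (f : δ → C) (h : β → δ) (l : List β) →
    sumM f (map h l) ≡ sumM (f ∘ h) l
  sum-map f h l = ≡.cong (foldr _∙_ ε) (≡.sym (ListP.map-∘ l))

  sum-++ : ∀ {b} {β : Set b} (f : β → C) (l₁ l₂ : List β) →
    sumM f (l₁ ++ l₂) ≈ sumM f l₁ ∙ sumM f l₂
  sum-++ f [] l₂ = sym (identityˡ _)
  sum-++ f (x ∷ l₁) l₂ = trans (∙-cong refl (sum-++ f l₁ l₂)) (sym (assoc _ _ _))

  sum-concatMap : ∀ {b d} {β : Set b} {δ : Set d} (f : β → C) (g : δ → List β) (l : List δ) →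
    sumM f (concatMap g l) ≈ sumM (λ x → sumM f (g x)) l
  sum-concatMap f g [] = refl
  sum-concatMap f g (x ∷ l) = trans (sum-++ f (g x) (concatMap g l)) (∙-cong refl (sum-concatMap f g l))

  sum-∙ : ∀ {b} {β : Set b} (f g : β → C) (l : List β) →
    sumM (λ x → f x ∙ g x) l ≈ sumM f l ∙ sumM g l
  sum-∙ f g [] = sym (identityˡ ε)
  sum-∙ f g (x ∷ l) = trans (∙-cong refl (sum-∙ f g l)) (interchange _ _ _ _)

  sum-swap : ∀ {b d} {β : Set b} {δ : Set d} (h : β → δ → C) (l₁ : List β) (l₂ : List δ) →
    sumM (λ x → sumM (h x) l₂) l₁ ≈ sumM (λ y → sumM (λ x → h x y) l₁) l₂
  sum-swap h [] l₂ = sym (sum-zero-All (All.universal (λ _ → refl) l₂))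
  sum-swap h (x ∷ l₁) l₂ = trans (∙-cong refl (sum-swap h l₁ l₂)) (sym (sum-∙ (h x) _ l₂))

  sum-↭ : ∀ {b} {β : Set b} (f : β → C) {l₁ l₂ : List β} → l₁ ↭ l₂ → sumM f l₁ ≈ sumM f l₂
  sum-↭ f Perm.refl = refl
  sum-↭ f (Perm.prep x p) = ∙-cong refl (sum-↭ f p)
  sum-↭ f (Perm.swap x y p) =
    trans (sym (assoc _ _ _)) (trans (∙-cong (comm _ _) (sum-↭ f p)) (assoc _ _ _))
  sum-↭ f (Perm.trans p q) = trans (sum-↭ f p) (sum-↭ f q)

module _ {c₁ ℓ₁ c₂ ℓ₂} (M₁ : CommutativeMonoid c₁ ℓ₁) (M₂ : CommutativeMonoid c₂ ℓ₂) where
  private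
    module M₁ = CommutativeMonoid M₁
    module M₂ = CommutativeMonoid M₂
    module S₁ = Sums M₁
    module S₂ = Sums M₂

  sum-hom : (h : M₁.Carrier → M₂.Carrier) → h M₁.ε M₂.≈ M₂.ε →
    (∀ u v → h (u M₁.∙ v) M₂.≈ h u M₂.∙ h v) →
    ∀ {b} {β : Set b} (f : β → M₁.Carrier) (l : List β) → h (S₁.sumM f l) M₂.≈ S₂.sumM (h ∘ f) l
  sum-hom h h-ε h-∙ f [] = h-ε
  sum-hom h h-ε h-∙ f (x ∷ l) = M₂.trans (h-∙ _ _) (M₂.∙-cong M₂.refl (sum-hom h h-ε h-∙ f l))

module RingSums {c ℓ} (R : CommutativeRing c ℓ) where
  open CommutativeRing R hiding (zero)
  module S+ = Sums +-commutativeMonoid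
  module S* = Sums *-commutativeMonoid
  open S+ public using () renaming (sumM to sumR)
  open S* public using () renaming (sumM to prodR)
  open import Algebra.Properties.Semiring.Exp semiring public using (_^_; ^-homo-*)

  sum-*ˡ : ∀ {b} {β : Set b} (u : Carrier) (f : β → Carrier) (l : List β) →
    u * sumR f l ≈ sumR (λ x → u * f x) l
  sum-*ˡ u f [] = zeroʳ u
  sum-*ˡ u f (x ∷ l) = trans (distribˡ _ _ _) (+-congˡ (sum-*ˡ u f l))

  sum-*ʳ : ∀ {b} {β : Set b} (u : Carrier) (f : β → Carrier) (l : List β) →
    sumR f l * u ≈ sumR (λ x → f x * u) l
  sum-*ʳ u f l = trans (*-comm _ _) (trans (sum-*ˡ u f l) (S+.sum-cong l (λ x → *-comm u (f x))))

  ^-suc-vanishes : ∀ {x} → x ≈ 0# → ∀ n → x ^ suc n ≈ 0#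
  ^-suc-vanishes x≈0 n = trans (*-congʳ x≈0) (zeroˡ _)

  ^-zero-agree : ∀ {x} → x ≈ 0# → ∀ m n → (m ≡ 0 → n ≡ 0) → (n ≡ 0 → m ≡ 0) → x ^ m ≈ x ^ n
  ^-zero-agree x≈0 zero zero _ _ = refl
  ^-zero-agree x≈0 zero (suc n) m0⇒n0 _ with () ← m0⇒n0 ≡.refl
  ^-zero-agree x≈0 (suc m) zero _ n0⇒m0 with () ← n0⇒m0 ≡.refl
  ^-zero-agree x≈0 (suc m) (suc n) _ _ = trans (^-suc-vanishes x≈0 m) (sym (^-suc-vanishes x≈0 n))

  sign : ℕ → Carrier
  sign n = if isEven n then 1# else - 1#

  sign-+ : ∀ m n → sign (m ℕ.+ n) ≈ sign m * sign n
  sign-+ zero n = sym (*-identityˡ _)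
  sign-+ (suc m) n = begin
    sign (suc (m ℕ.+ n)) ≈⟨ sign-suc (isEven (m ℕ.+ n)) ⟩
    - sign (m ℕ.+ n)     ≈⟨ -‿cong (sign-+ m n) ⟩
    - (sign m * sign n)  ≈⟨ -‿distribˡ-* _ _ ⟩
    (- sign m) * sign n  ≈⟨ *-congʳ (sign-suc (isEven m)) ⟨
    sign (suc m) * sign n ∎
    where
    open import Relation.Binary.Reasoning.Setoid setoid
    open import Algebra.Properties.Ring ring using (-‿involutive; -‿distribˡ-*)
    sign-suc : ∀ e → (if (if e then false else true) then 1# else - 1#) ≈ - (if e then 1# else - 1#)
    sign-suc true = refl
    sign-suc false = sym (-‿involutive 1#)

-- Coefficient lists, compared coefficientwise (_≈P_), form a commutative
-- ring; so sums and products of polynomial entries can be rearranged with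
-- the generic lemmas above.
module Polynomials {c ℓ} (R : CommutativeRing c ℓ) where
  open CommutativeRing R hiding (zero)
  open OverRing R
  open import Algebra.Properties.Ring ring using (-0#≈0#)
  open import Relation.Binary.Reasoning.Setoid setoid

  -- _≈P_ wrapped in a record, so that the compared polynomials can be
  -- inferred from a proof.
  infix 4 _≋_
  record _≋_ (p q : Poly) : Set ℓ where
    constructor mk
    field get : p ≈P q
  open _≋_ public

  coeff-+ : ∀ p q n → coeff (p +P q) n ≈ coeff p n + coeff q n
  coeff-+ [] q n = sym (+-identityˡ _)
  coeff-+ (p ∷ ps) [] n = sym (+-identityʳ _)
  coeff-+ (p ∷ ps) (q ∷ qs) zero = refl
  coeff-+ (p ∷ ps) (q ∷ qs) (suc n) = coeff-+ ps qs n

  coeff-neg : ∀ p n → coeff (-P p) n ≈ - coeff p n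
  coeff-neg [] n = sym -0#≈0#
  coeff-neg (p ∷ ps) zero = refl
  coeff-neg (p ∷ ps) (suc n) = coeff-neg ps n

  coeff-· : ∀ r p n → coeff (r ·P p) n ≈ r * coeff p n
  coeff-· r [] n = sym (zeroʳ r)
  coeff-· r (p ∷ ps) zero = refl
  coeff-· r (p ∷ ps) (suc n) = coeff-· r ps n

  P-refl : ∀ {p} → p ≋ p
  P-refl = mk λ n → refl
  P-sym : ∀ {p q} → p ≋ q → q ≋ p
  P-sym e = mk λ n → sym (get e n)
  P-trans : ∀ {p q r} → p ≋ q → q ≋ r → p ≋ r
  P-trans e f = mk λ n → trans (get e n) (get f n)

  ∷-cong : ∀ {a b p q} → a ≈ b → p ≋ q → (a ∷ p) ≋ (b ∷ q)
  ∷-cong e f = mk λ { zero → e ; (suc n) → get f n }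

  0∷[] : ∀ {p} → p ≋ [] → (0# ∷ p) ≋ []
  0∷[] e = mk λ { zero → refl ; (suc n) → get e n }

  +P-cong : ∀ {p p' q q'} → p ≋ p' → q ≋ q' → (p +P q) ≋ (p' +P q')
  +P-cong {p} {p'} {q} {q'} e f = mk λ n → trans (coeff-+ p q n) (trans (+-cong (get e n) (get f n)) (sym (coeff-+ p' q' n)))

  +P-assoc : ∀ p q r → ((p +P q) +P r) ≋ (p +P (q +P r))
  +P-assoc p q r = mk λ n → begin
    coeff ((p +P q) +P r) n ≈⟨ coeff-+ (p +P q) r n ⟩
    coeff (p +P q) n + coeff r n ≈⟨ +-cong (coeff-+ p q n) refl ⟩
    (coeff p n + coeff q n) + coeff r n ≈⟨ +-assoc _ _ _ ⟩
    coeff p n + (coeff q n + coeff r n) ≈⟨ +-cong refl (sym (coeff-+ q r n)) ⟩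
    coeff p n + coeff (q +P r) n ≈⟨ sym (coeff-+ p (q +P r) n) ⟩
    coeff (p +P (q +P r)) n ∎

  +P-comm : ∀ p q → (p +P q) ≋ (q +P p)
  +P-comm p q = mk λ n → trans (coeff-+ p q n) (trans (+-comm _ _) (sym (coeff-+ q p n)))

  +P-identityˡ : ∀ p → ([] +P p) ≋ p
  +P-identityˡ p = P-refl
  +P-identityʳ : ∀ p → (p +P []) ≋ p
  +P-identityʳ p = mk λ n → trans (coeff-+ p [] n) (+-identityʳ _)

  -P-cong : ∀ {p q} → p ≋ q → (-P p) ≋ (-P q)
  -P-cong {p} {q} e = mk λ n → trans (coeff-neg p n) (trans (-‿cong (get e n)) (sym (coeff-neg q n)))

  -P-inverseˡ : ∀ p → ((-P p) +P p) ≋ []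
  -P-inverseˡ p = mk λ n → trans (coeff-+ (-P p) p n) (trans (+-cong (coeff-neg p n) refl) (-‿inverseˡ _))
  -P-inverseʳ : ∀ p → (p +P (-P p)) ≋ []
  -P-inverseʳ p = mk λ n → trans (coeff-+ p (-P p) n) (trans (+-cong refl (coeff-neg p n)) (-‿inverseʳ _))

  ·P-cong : ∀ {r r' p p'} → r ≈ r' → p ≋ p' → (r ·P p) ≋ (r' ·P p')
  ·P-cong {r} {r'} {p} {p'} e f = mk λ n → trans (coeff-· r p n) (trans (*-cong e (get f n)) (sym (coeff-· r' p' n)))

  ·P-zero : ∀ {r} p → r ≈ 0# → (r ·P p) ≋ []
  ·P-zero {r} p e = mk λ n → trans (coeff-· r p n) (trans (*-congʳ e) (zeroˡ _))

  ·P-distrib : ∀ r p q → (r ·P (p +P q)) ≋ ((r ·P p) +P (r ·P q))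
  ·P-distrib r p q = mk λ n → begin
    coeff (r ·P (p +P q)) n ≈⟨ coeff-· r (p +P q) n ⟩
    r * coeff (p +P q) n ≈⟨ *-congˡ (coeff-+ p q n) ⟩
    r * (coeff p n + coeff q n) ≈⟨ distribˡ _ _ _ ⟩
    r * coeff p n + r * coeff q n ≈⟨ +-cong (sym (coeff-· r p n)) (sym (coeff-· r q n)) ⟩
    coeff (r ·P p) n + coeff (r ·P q) n ≈⟨ sym (coeff-+ (r ·P p) (r ·P q) n) ⟩
    coeff ((r ·P p) +P (r ·P q)) n ∎

  ·P-+ : ∀ r r' p → ((r + r') ·P p) ≋ ((r ·P p) +P (r' ·P p))
  ·P-+ r r' p = mk λ n → begin
    coeff ((r + r') ·P p) n ≈⟨ coeff-· (r + r') p n ⟩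
    (r + r') * coeff p n ≈⟨ distribʳ _ _ _ ⟩
    r * coeff p n + r' * coeff p n ≈⟨ +-cong (sym (coeff-· r p n)) (sym (coeff-· r' p n)) ⟩
    coeff (r ·P p) n + coeff (r' ·P p) n ≈⟨ sym (coeff-+ (r ·P p) (r' ·P p) n) ⟩
    coeff ((r ·P p) +P (r' ·P p)) n ∎

  ·P-assoc : ∀ r r' p → (r ·P (r' ·P p)) ≋ ((r * r') ·P p)
  ·P-assoc r r' p = mk λ n → begin
    coeff (r ·P (r' ·P p)) n ≈⟨ coeff-· r (r' ·P p) n ⟩
    r * coeff (r' ·P p) n ≈⟨ *-congˡ (coeff-· r' p n) ⟩
    r * (r' * coeff p n) ≈⟨ sym (*-assoc _ _ _) ⟩
    (r * r') * coeff p n ≈⟨ sym (coeff-· (r * r') p n) ⟩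
    coeff ((r * r') ·P p) n ∎

  ·P-one : ∀ p → (1# ·P p) ≋ p
  ·P-one p = mk λ n → trans (coeff-· 1# p n) (*-identityˡ _)

  *P-zeroL : ∀ p q → p ≋ [] → (p *P q) ≋ []
  *P-zeroL [] q e = P-refl
  *P-zeroL (a ∷ ps) q e =
    +P-cong (·P-zero q (get e zero)) (0∷[] (*P-zeroL ps q (mk λ n → get e (suc n))))

  *P-congˡ : ∀ {p p'} q → p ≋ p' → (p *P q) ≋ (p' *P q)
  *P-congˡ {[]} {[]} q e = P-refl
  *P-congˡ {[]} {b ∷ ps'} q e = P-sym (*P-zeroL (b ∷ ps') q (P-sym e))
  *P-congˡ {a ∷ ps} {[]} q e = *P-zeroL (a ∷ ps) q e
  *P-congˡ {a ∷ ps} {b ∷ ps'} q e =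
    +P-cong (·P-cong (get e zero) P-refl) (∷-cong refl (*P-congˡ {ps} {ps'} q (mk λ n → get e (suc n))))

  *P-congʳ : ∀ p {q q'} → q ≋ q' → (p *P q) ≋ (p *P q')
  *P-congʳ [] e = P-refl
  *P-congʳ (a ∷ ps) e = +P-cong (·P-cong refl e) (∷-cong refl (*P-congʳ ps e))

  *P-zeroR : ∀ p → (p *P []) ≋ []
  *P-zeroR [] = P-refl
  *P-zeroR (a ∷ ps) = 0∷[] (*P-zeroR ps)

  ·P-*P : ∀ r p q → ((r ·P p) *P q) ≋ (r ·P (p *P q))
  ·P-*P r [] q = P-refl
  ·P-*P r (a ∷ ps) q = P-trans
    (+P-cong (P-sym (·P-assoc r a q)) (∷-cong (sym (zeroʳ r)) (·P-*P r ps q)))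
    (P-sym (·P-distrib r (a ·P q) (0# ∷ (ps *P q))))

  swap-mid : ∀ u v w → (u +P (v +P w)) ≋ (v +P (u +P w))
  swap-mid u v w = P-trans (P-sym (+P-assoc u v w)) (P-trans (+P-cong (+P-comm u v) P-refl) (+P-assoc v u w))

  *P-consʳ : ∀ p a q → (p *P (a ∷ q)) ≋ ((a ·P p) +P (0# ∷ (p *P q)))
  *P-consʳ [] a q = P-sym (0∷[] P-refl)
  *P-consʳ (b ∷ ps) a q = ∷-cong (trans (+-identityʳ _) (trans (*-comm b a) (sym (+-identityʳ _))))
    (P-trans (+P-cong P-refl (*P-consʳ ps a q)) (swap-mid (b ·P q) (a ·P ps) (0# ∷ (ps *P q))))

  *P-comm : ∀ p q → (p *P q) ≋ (q *P p)
  *P-comm [] q = P-sym (*P-zeroR q)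
  *P-comm (a ∷ ps) q = P-trans (+P-cong P-refl (∷-cong refl (*P-comm ps q))) (P-sym (*P-consʳ q a ps))

  0∷-+ : ∀ u v → (0# ∷ (u +P v)) ≋ ((0# ∷ u) +P (0# ∷ v))
  0∷-+ u v = ∷-cong (sym (+-identityʳ _)) P-refl

  interchangeP : ∀ a b c d → ((a +P b) +P (c +P d)) ≋ ((a +P c) +P (b +P d))
  interchangeP a b c d = P-trans (+P-assoc a b (c +P d)) (P-trans (+P-cong (P-refl {a}) (swap-mid b c d)) (P-sym (+P-assoc a c (b +P d))))

  *P-distribʳ : ∀ p p' q → ((p +P p') *P q) ≋ ((p *P q) +P (p' *P q))
  *P-distribʳ [] p' q = P-refl
  *P-distribʳ (a ∷ ps) [] q = P-sym (+P-identityʳ _)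
  *P-distribʳ (a ∷ ps) (b ∷ ps') q = P-trans
    (+P-cong (·P-+ a b q) (P-trans (∷-cong refl (*P-distribʳ ps ps' q)) (0∷-+ (ps *P q) (ps' *P q))))
    (interchangeP (a ·P q) (b ·P q) (0# ∷ (ps *P q)) (0# ∷ (ps' *P q)))

  *P-distribˡ : ∀ p q q' → (p *P (q +P q')) ≋ ((p *P q) +P (p *P q'))
  *P-distribˡ p q q' = P-trans (*P-comm p (q +P q'))
    (P-trans (*P-distribʳ q q' p) (+P-cong (*P-comm q p) (*P-comm q' p)))

  *P-assoc : ∀ p q r → ((p *P q) *P r) ≋ (p *P (q *P r))
  *P-assoc [] q r = P-refl
  *P-assoc (a ∷ ps) q r = P-trans (*P-distribʳ (a ·P q) (0# ∷ (ps *P q)) r)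
    (+P-cong (·P-*P a q r)
      (P-trans (+P-cong (·P-zero r refl) P-refl) (∷-cong refl (*P-assoc ps q r))))

  *P-identityˡ : ∀ p → (1P *P p) ≋ p
  *P-identityˡ p = P-trans (+P-cong (·P-one p) (0∷[] P-refl)) (+P-identityʳ p)

  *P-identityʳ : ∀ p → (p *P 1P) ≋ p
  *P-identityʳ p = P-trans (*P-comm p 1P) (*P-identityˡ p)

  PolyRing : CommutativeRing c ℓ
  PolyRing = record
    { Carrier = Poly ; _≈_ = _≋_ ; _+_ = _+P_ ; _*_ = _*P_ ; -_ = -P_ ; 0# = 0P ; 1# = 1P
    ; isCommutativeRing = record
      { isRing = record
        { +-isAbelianGroup = record
          { isGroup = record
            { isMonoid = record
              { isSemigroup = record
                { isMagma = record
                  { isEquivalence = record { refl = P-refl ; sym = P-sym ; trans = P-trans }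
                  ; ∙-cong = +P-cong }
                ; assoc = +P-assoc }
              ; identity = +P-identityˡ , +P-identityʳ }
            ; inverse = -P-inverseˡ , -P-inverseʳ
            ; ⁻¹-cong = -P-cong }
          ; comm = +P-comm }
        ; *-cong = λ {p} {p'} {q} {q'} e f → P-trans (*P-congˡ q e) (*P-congʳ p' f)
        ; *-assoc = *P-assoc
        ; *-identity = *P-identityˡ , *P-identityʳ
        ; distrib = *P-distribˡ , (λ q p p' → *P-distribʳ p p' q) }
      ; *-comm = *P-comm } }

module Evaluation {c ℓ} (R : CommutativeRing c ℓ) where
  open CommutativeRing R hiding (zero)
  open OverRing R
  open Polynomials R
  open RingSums R
  private
    module PR = RingSums PolyRing
    module PRing = CommutativeRing PolyRing
  open import Algebra.Properties.Ring ring using (-0#≈0#; -‿distribʳ-*; -‿+-comm)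
  open import Algebra.Properties.CommutativeSemigroup +-commutativeSemigroup using (interchange)
  open import Algebra.Properties.CommutativeSemigroup *-commutativeSemigroup using (x∙yz≈y∙xz)
  open import Relation.Binary.Reasoning.Setoid setoid

  eval-+ : ∀ p q t → eval (p +P q) t ≈ eval p t + eval q t
  eval-+ [] q t = sym (+-identityˡ _)
  eval-+ (p ∷ ps) [] t = sym (+-identityʳ _)
  eval-+ (p ∷ ps) (q ∷ qs) t = begin
    (p + q) + t * eval (ps +P qs) t ≈⟨ +-congˡ (*-congˡ (eval-+ ps qs t)) ⟩
    (p + q) + t * (eval ps t + eval qs t) ≈⟨ +-congˡ (distribˡ _ _ _) ⟩
    (p + q) + (t * eval ps t + t * eval qs t) ≈⟨ interchange _ _ _ _ ⟩
    (p + t * eval ps t) + (q + t * eval qs t) ∎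

  eval-· : ∀ r p t → eval (r ·P p) t ≈ r * eval p t
  eval-· r [] t = sym (zeroʳ r)
  eval-· r (a ∷ ps) t = begin
    r * a + t * eval (r ·P ps) t ≈⟨ +-congˡ (*-congˡ (eval-· r ps t)) ⟩
    r * a + t * (r * eval ps t) ≈⟨ +-congˡ (x∙yz≈y∙xz t r _) ⟩
    r * a + r * (t * eval ps t) ≈⟨ sym (distribˡ _ _ _) ⟩
    r * (a + t * eval ps t) ∎

  eval-* : ∀ p q t → eval (p *P q) t ≈ eval p t * eval q t
  eval-* [] q t = sym (zeroˡ _)
  eval-* (a ∷ ps) q t = begin
    eval ((a ·P q) +P (0# ∷ (ps *P q))) t ≈⟨ eval-+ (a ·P q) (0# ∷ (ps *P q)) t ⟩
    eval (a ·P q) t + (0# + t * eval (ps *P q) t) ≈⟨ +-cong (eval-· a q t) (trans (+-identityˡ _) (*-congˡ (eval-* ps q t))) ⟩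
    a * eval q t + t * (eval ps t * eval q t) ≈⟨ +-congˡ (sym (*-assoc _ _ _)) ⟩
    a * eval q t + (t * eval ps t) * eval q t ≈⟨ sym (distribʳ _ _ _) ⟩
    (a + t * eval ps t) * eval q t ∎

  eval-neg : ∀ p t → eval (-P p) t ≈ - eval p t
  eval-neg [] t = sym -0#≈0#
  eval-neg (a ∷ ps) t = begin
    - a + t * eval (-P ps) t ≈⟨ +-congˡ (*-congˡ (eval-neg ps t)) ⟩
    - a + t * - eval ps t ≈⟨ +-congˡ (sym (-‿distribʳ-* t (eval ps t))) ⟩
    - a + - (t * eval ps t) ≈⟨ -‿+-comm a (t * eval ps t) ⟩
    - (a + t * eval ps t) ∎

  eval-1 : ∀ t → eval 1P t ≈ 1#
  eval-1 t = trans (+-congˡ (zeroʳ t)) (+-identityʳ 1#)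

  eval-sum : ∀ {b} {β : Set b} (f : β → Poly) (l : List β) t →
    eval (PR.sumR f l) t ≈ sumR (λ x → eval (f x) t) l
  eval-sum f l t = sum-hom PRing.+-commutativeMonoid +-commutativeMonoid
    (λ p → eval p t) refl (λ p q → eval-+ p q t) f l

  eval-prod : ∀ {b} {β : Set b} (f : β → Poly) (l : List β) t →
    eval (PR.prodR f l) t ≈ prodR (λ x → eval (f x) t) l
  eval-prod f l t = sum-hom PRing.*-commutativeMonoid *-commutativeMonoid
    (λ p → eval p t) (eval-1 t) (λ p q → eval-* p q t) f l

  eval-pow : ∀ p n t → eval (p PR.^ n) t ≈ eval p t ^ n
  eval-pow p zero t = eval-1 t
  eval-pow p (suc n) t = trans (eval-* p (p PR.^ n) t) (*-congˡ (eval-pow p n t))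

data Pick {a} {α : Set a} : List α → α → List α → Set a where
  here : ∀ {y ys} → Pick (y ∷ ys) y ys
  there : ∀ {y ys z r} → Pick ys z r → Pick (y ∷ ys) z (y ∷ r)

picks-Pick : ∀ {a} {α : Set a} (ys : List α) → All (λ yr → Pick ys (proj₁ yr) (proj₂ yr)) (picks ys)
picks-Pick [] = []
picks-Pick (y ∷ ys) = here ∷ AllP.map⁺ (All.map there (picks-Pick ys))

Pick-↭ : ∀ {a} {α : Set a} {ys : List α} {y r} → Pick ys y r → ys ↭ y ∷ r
Pick-↭ here = Perm.refl
Pick-↭ (there pk) = ↭-trans (Perm.prep _ (Pick-↭ pk)) (Perm.swap _ _ Perm.refl)

Pick-shorter : ∀ {a} {α : Set a} {ys : List α} {y r n} → Pick ys y r → length ys ≤ n → length r ≤ n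
Pick-shorter {n = n} pk l = ℕP.≤-trans (ℕP.n≤1+n _) (≡.subst (_≤ n) (PermP.↭-length (Pick-↭ pk)) l)

points : ∀ {a} {α : Set a} → List (α × α) → List α
points [] = []
points ((x , y) ∷ π) = x ∷ y ∷ points π

matchingsF-points : ∀ {a} {α : Set a} n (xs : List α) → All (λ π → points π ↭ xs) (matchingsF n xs)
matchingsF-points _ [] = Perm.refl ∷ []
matchingsF-points zero (_ ∷ _) = []
matchingsF-points (suc n) (x ∷ xs) = AllP.concat⁺ (AllP.map⁺ (All.map (λ {yr} pk →
  AllP.map⁺ (All.map (λ covers → Perm.prep x (↭-trans (Perm.prep _ covers) (↭-sym (Pick-↭ pk))))
    (matchingsF-points n (proj₂ yr)))) (picks-Pick xs)))

matchings-within : ∀ {a q} {α : Set a} {Q : Pred α q} (xs : List α) → All Q xs →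
  All (All (λ p → Q (proj₁ p) × Q (proj₂ p))) (matchings xs)
matchings-within xs qs = All.map (λ covers → pairs (PermP.All-resp-↭ (↭-sym covers) qs))
  (matchingsF-points (length xs) xs)
  where
  pairs : ∀ {π} → All _ (points π) → All _ π
  pairs {[]} [] = []
  pairs {_ ∷ _} (qx ∷ qy ∷ qs) = (qx , qy) ∷ pairs qs

matchingsF-enough : ∀ {a} {α : Set a} n (xs : List α) → length xs ≤ n → matchingsF n xs ≡ matchings xs
matchingsF-enough n xs l = fuel n (length xs) xs l ℕP.≤-refl
  where
  fuel : ∀ {a} {α : Set a} n m (xs : List α) → length xs ≤ n → length xs ≤ m → matchingsF n xs ≡ matchingsF m xs
  fuel _ _ [] _ _ = ≡.refl
  fuel (suc n) (suc m) (x ∷ xs) (s≤s ln) (s≤s lm) = ≡.cong concat (ListP.map-cong-local (All.map (λ {yr} pk →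
    ≡.cong (map _) (fuel n m (proj₂ yr) (Pick-shorter pk ln) (Pick-shorter pk lm))) (picks-Pick xs)))

module MatchingSums {c ℓ} (M : CommutativeMonoid c ℓ) {a} {α : Set a} where
  open CommutativeMonoid M renaming (Carrier to C)
  open Sums M
  open import Relation.Binary.Reasoning.Setoid setoid

  Matching : Set a
  Matching = List (α × α)

  sum-points : ∀ (f : α → C) π → sumM (λ p → f (proj₁ p) ∙ f (proj₂ p)) π ≈ sumM f (points π)
  sum-points f [] = refl
  sum-points f ((x , y) ∷ π) = trans (assoc _ _ _) (∙-cong refl (∙-cong refl (sum-points f π)))

  sum-matchingsF-cons : ∀ (g : Matching → C) n x xs → sumM g (matchingsF (suc n) (x ∷ xs))
    ≈ sumM (λ yr → sumM (λ π → g ((x , proj₁ yr) ∷ π)) (matchingsF n (proj₂ yr))) (picks xs)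
  sum-matchingsF-cons g n x xs = trans (sum-concatMap g _ (picks xs))
    (sum-cong (picks xs) (λ yr → reflexive (sum-map g _ (matchingsF n (proj₂ yr)))))

  sum-matchings-cons : ∀ (g : Matching → C) x xs → sumM g (matchings (x ∷ xs))
    ≈ sumM (λ yr → sumM (λ π → g ((x , proj₁ yr) ∷ π)) (matchings (proj₂ yr))) (picks xs)
  sum-matchings-cons g x xs = trans (sum-matchingsF-cons g (length xs) x xs)
    (sum-cong-All (All.map (λ {yr} pk → reflexive (≡.cong (sumM _)
      (matchingsF-enough (length xs) (proj₂ yr) (Pick-shorter pk ℕP.≤-refl)))) (picks-Pick xs)))

  sideTerm : ∀ {p₁ p₂} {P₁ : Pred α p₁} {P₂ : Pred α p₂} → Decidable P₁ → Decidable P₂ →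
    (α → List α → List α → C) → α × List α → C
  sideTerm P₁? P₂? S yr =
    if does (P₁? (proj₁ yr)) then S (proj₁ yr) (filter P₁? (proj₂ yr)) (filter P₂? (proj₂ yr)) else ε

  sum-sideTerm-push : ∀ {p₁ p₂} {P₁ : Pred α p₁} {P₂ : Pred α p₂} (P₁? : Decidable P₁) (P₂? : Decidable P₂)
    {S S′ : α → List α → List α → C} z →
    (∀ w ws → S w (filter P₁? (z ∷ ws)) (filter P₂? (z ∷ ws)) ≡ S′ w (filter P₁? ws) (filter P₂? ws)) →
    ∀ l → sumM (sideTerm P₁? P₂? S) (map (λ { (w , ws) → (w , z ∷ ws) }) l) ≈ sumM (sideTerm P₁? P₂? S′) l
  sum-sideTerm-push P₁? P₂? z eq l = trans (reflexive (sum-map _ _ l)) (sum-cong l (λ yr →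
    reflexive (≡.cong (λ v → if does (P₁? (proj₁ yr)) then v else ε) (eq (proj₁ yr) (proj₂ yr)))))

  sum-picks-filter : ∀ {p₁ p₂} {P₁ : Pred α p₁} {P₂ : Pred α p₂} (P₁? : Decidable P₁) (P₂? : Decidable P₂) →
    (∀ {z} → P₁ z → ¬ P₂ z) → (∀ {z} → ¬ P₁ z → P₂ z) →
    ∀ (S : α → List α → List α → C) zs →
    sumM (sideTerm P₁? P₂? S) (picks zs) ≈ sumM (λ yr → S (proj₁ yr) (proj₂ yr) (filter P₂? zs)) (picks (filter P₁? zs))
  sum-picks-filter P₁? P₂? only₁ else₂ S [] = refl
  sum-picks-filter P₁? P₂? only₁ else₂ S (z ∷ zs) with P₁? z | P₂? z
  ... | yes p₁z | yes p₂z = ⊥-elim (only₁ p₁z p₂z)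
  ... | no ¬p₁z | no ¬p₂z = ⊥-elim (¬p₂z (else₂ ¬p₁z))
  ... | yes p₁z | no ¬p₂z = ∙-cong refl (begin
    sumM (sideTerm P₁? P₂? S) (map (λ { (w , ws) → (w , z ∷ ws) }) (picks zs))
      ≈⟨ sum-sideTerm-push P₁? P₂? {S} {λ w r₁ r₂ → S w (z ∷ r₁) r₂} z (λ w ws →
           ≡.cong₂ (S w) (ListP.filter-accept P₁? {xs = ws} p₁z) (ListP.filter-reject P₂? {xs = ws} ¬p₂z)) (picks zs) ⟩
    sumM (sideTerm P₁? P₂? (λ w r₁ r₂ → S w (z ∷ r₁) r₂)) (picks zs)
      ≈⟨ sum-picks-filter P₁? P₂? only₁ else₂ (λ w r₁ r₂ → S w (z ∷ r₁) r₂) zs ⟩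
    sumM (λ yr → S (proj₁ yr) (z ∷ proj₂ yr) (filter P₂? zs)) (picks (filter P₁? zs))
      ≡⟨ sum-map (λ yr → S (proj₁ yr) (proj₂ yr) (filter P₂? zs)) _ (picks (filter P₁? zs)) ⟨
    sumM (λ yr → S (proj₁ yr) (proj₂ yr) (filter P₂? zs)) (map (λ { (w , ws) → (w , z ∷ ws) }) (picks (filter P₁? zs))) ∎)
  ... | no ¬p₁z | yes p₂z = trans (identityˡ _) (begin
    sumM (sideTerm P₁? P₂? S) (map (λ { (w , ws) → (w , z ∷ ws) }) (picks zs))
      ≈⟨ sum-sideTerm-push P₁? P₂? {S} {λ w r₁ r₂ → S w r₁ (z ∷ r₂)} z (λ w ws →
           ≡.cong₂ (S w) (ListP.filter-reject P₁? {xs = ws} ¬p₁z) (ListP.filter-accept P₂? {xs = ws} p₂z)) (picks zs) ⟩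
    sumM (sideTerm P₁? P₂? (λ w r₁ r₂ → S w r₁ (z ∷ r₂))) (picks zs)
      ≈⟨ sum-picks-filter P₁? P₂? only₁ else₂ (λ w r₁ r₂ → S w r₁ (z ∷ r₂)) zs ⟩
    sumM (λ yr → S (proj₁ yr) (proj₂ yr) (z ∷ filter P₂? zs)) (picks (filter P₁? zs)) ∎)

  module Split {p} {P : Pred α p} (P? : Decidable P) where
    ¬P? : Decidable (λ x → ¬ P x)
    ¬P? x = ¬? (P? x)

    Mixed : α → α → Set p
    Mixed x y = (P x × ¬ P y) ⊎ (¬ P x × P y)

    -- The functions whose sum over matchings splits: they vanish on
    -- matchings with a mixed pair and do not depend on the order of pairs.
    record Splittable (F : Matching → C) : Set (a ⊔ p ⊔ ℓ) where
      field
        mixed-vanishes : ∀ {x y} → Mixed x y → ∀ π → F ((x , y) ∷ π) ≈ ε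
        reorder : ∀ {π π′} → π ↭ π′ → F π ≈ F π′
    open Splittable

    splittable-cons : ∀ {F} x y → Splittable F → Splittable (λ π → F ((x , y) ∷ π))
    splittable-cons x y sF = record
      { mixed-vanishes = λ m π → trans (reorder sF (Perm.swap _ _ Perm.refl)) (mixed-vanishes sF m ((x , y) ∷ π))
      ; reorder = λ e → reorder sF (Perm.prep _ e) }

    doubleSum : List α → List α → (Matching → C) → C
    doubleSum ys zs F = sumM (λ σ → sumM (λ τ → F (σ ++ τ)) (matchings zs)) (matchings ys)

    splitSum : List α → (Matching → C) → C
    splitSum xs = doubleSum (filter ¬P? xs) (filter P? xs)

    -- Expanding by the partner y of x, where Q is the side of x: partners on
    -- the other side give mixed pairs, the others are split by induction.
    sum-by-partner : ∀ {q} {Q : Pred α q} (Q? : Decidable Q) {x F} → (∀ {y} → ¬ Q y → Mixed x y) →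
      Splittable F → ∀ n xs → length xs ≤ n →
      (∀ r → length r ≤ n → ∀ {G} → Splittable G → sumM G (matchingsF n r) ≈ splitSum r G) →
      sumM F (matchingsF (suc n) (x ∷ xs))
        ≈ sumM (λ yr → if does (Q? (proj₁ yr)) then splitSum (proj₂ yr) (λ π → F ((x , proj₁ yr) ∷ π)) else ε) (picks xs)
    sum-by-partner Q? {x} {F} mixed sF n xs l split =
      trans (sum-matchingsF-cons F n x xs) (sum-cong-All (All.map (λ {yr} → by-partner yr) (picks-Pick xs)))
      where
      by-partner : ∀ yr → Pick xs (proj₁ yr) (proj₂ yr) →
        sumM (λ π → F ((x , proj₁ yr) ∷ π)) (matchingsF n (proj₂ yr))
          ≈ (if does (Q? (proj₁ yr)) then splitSum (proj₂ yr) (λ π → F ((x , proj₁ yr) ∷ π)) else ε)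
      by-partner (y , r) pk with Q? y
      ... | yes _ = split r (Pick-shorter pk l) (splittable-cons x y sF)
      ... | no ¬qy = sum-zero-All (All.universal (mixed-vanishes sF (mixed ¬qy)) (matchingsF n r))

    split-sum : ∀ n xs → length xs ≤ n → ∀ {F} → Splittable F → sumM F (matchingsF n xs) ≈ splitSum xs F
    split-sum n [] _ _ = sym (identityʳ _)
    split-sum (suc n) (x ∷ xs) (s≤s l) {F} sF with P? x
    ... | no ¬px = begin
      sumM F (matchingsF (suc n) (x ∷ xs))
        ≈⟨ sum-by-partner ¬P? (λ ¬¬py → inj₂ (¬px , decidable-stable (P? _) ¬¬py)) sF n xs l (split-sum n) ⟩
      sumM (sideTerm ¬P? P? S) (picks xs)
        ≈⟨ sum-picks-filter ¬P? P? (λ ¬pz pz → ¬pz pz) (decidable-stable (P? _)) S xs ⟩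
      sumM (λ yr → S (proj₁ yr) (proj₂ yr) (filter P? xs)) (picks (filter ¬P? xs))
        ≈⟨ sym (sum-matchings-cons _ x (filter ¬P? xs)) ⟩
      doubleSum (x ∷ filter ¬P? xs) (filter P? xs) F ∎
      where
      S : α → List α → List α → C
      S y ys zs = doubleSum ys zs (λ π → F ((x , y) ∷ π))
    ... | yes px = begin
      sumM F (matchingsF (suc n) (x ∷ xs))
        ≈⟨ sum-by-partner P? (λ ¬py → inj₁ (px , ¬py)) sF n xs l (split-sum n) ⟩
      sumM (sideTerm P? ¬P? S) (picks xs)
        ≈⟨ sum-picks-filter P? ¬P? (λ pz ¬pz → ¬pz pz) (λ ¬pz → ¬pz) S xs ⟩
      sumM (λ yr → S (proj₁ yr) (proj₂ yr) outs) (picks ins)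
        ≈⟨ sum-swap (λ yr σ → sumM (λ τ → F ((x , proj₁ yr) ∷ σ ++ τ)) (matchings (proj₂ yr))) (picks ins) (matchings outs) ⟩
      sumM (λ σ → sumM (λ yr → sumM (λ τ → F ((x , proj₁ yr) ∷ σ ++ τ)) (matchings (proj₂ yr))) (picks ins)) (matchings outs)
        ≈⟨ sum-cong (matchings outs) (λ σ → sum-cong (picks ins) (λ yr → sum-cong (matchings (proj₂ yr)) (λ τ →
             reorder sF (↭-sym (PermP.shift (x , proj₁ yr) σ τ))))) ⟩
      sumM (λ σ → sumM (λ yr → sumM (λ τ → F (σ ++ (x , proj₁ yr) ∷ τ)) (matchings (proj₂ yr))) (picks ins)) (matchings outs)
        ≈⟨ sum-cong (matchings outs) (λ σ → sym (sum-matchings-cons (λ τ → F (σ ++ τ)) x ins)) ⟩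
      doubleSum outs (x ∷ ins) F ∎
      where
      outs ins : List α
      outs = filter ¬P? xs
      ins = filter P? xs
      S : α → List α → List α → C
      S y zs ys = doubleSum ys zs (λ π → F ((x , y) ∷ π))

module Σℕ = Sums ℕP.+-0-commutativeMonoid

count : Bool → ℕ
count true = 1
count false = 0

inInterval? : (a b m : ℕ) → Dec (a ≤ m × m < b)
inInterval? a b m = (a ℕP.≤? m) ×-dec (suc m ℕP.≤? b)

interval-count : ∀ a b n → Σℕ.sumM (λ m → count (does (inInterval? a b m))) (upTo n) ≡ (n ℕ.⊓ b) ∸ a
interval-count a b zero = ≡.sym (ℕP.0∸n≡0 a)
interval-count a b (suc n) = begin
  Σℕ.sumM f (upTo (suc n))         ≡⟨ ≡.cong (Σℕ.sumM f) (≡.sym (ListP.upTo-∷ʳ n)) ⟩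
  Σℕ.sumM f (upTo n ++ [ n ])      ≡⟨ Σℕ.sum-++ f (upTo n) [ n ] ⟩
  Σℕ.sumM f (upTo n) ℕ.+ (f n ℕ.+ 0) ≡⟨ ≡.cong₂ ℕ._+_ (interval-count a b n) (ℕP.+-identityʳ (f n)) ⟩
  (n ℕ.⊓ b) ∸ a ℕ.+ f n            ≡⟨ step (inInterval? a b n) ⟩
  (suc n ℕ.⊓ b) ∸ a                ∎
  where
  open ≡.≡-Reasoning
  f : ℕ → ℕ
  f m = count (does (inInterval? a b m))
  step : (d : Dec (a ≤ n × n < b)) → (n ℕ.⊓ b) ∸ a ℕ.+ count (does d) ≡ (suc n ℕ.⊓ b) ∸ a
  step (yes (a≤n , n<b)) rewrite ℕP.m≤n⇒m⊓n≡m (ℕP.<⇒≤ n<b) | ℕP.m≤n⇒m⊓n≡m n<b =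
    ≡.trans (ℕP.+-comm _ 1) (≡.sym (ℕP.+-∸-assoc 1 a≤n))
  step (no ∉) with a ℕP.≤? n
  ... | yes a≤n = ≡.trans (ℕP.+-identityʳ _) (≡.cong (_∸ a)
    (≡.trans (ℕP.m≥n⇒m⊓n≡n b≤n) (≡.sym (ℕP.m≥n⇒m⊓n≡n (ℕP.≤-trans b≤n (ℕP.n≤1+n n))))))
    where
    b≤n : b ≤ n
    b≤n = ℕP.≮⇒≥ (λ n<b → ∉ (a≤n , n<b))
  ... | no a≰n = ≡.trans (ℕP.+-identityʳ _) (≡.trans
    (ℕP.m≤n⇒m∸n≡0 (ℕP.≤-trans (ℕP.m⊓n≤m n b) (ℕP.<⇒≤ (ℕP.≰⇒> a≰n))))
    (≡.sym (ℕP.m≤n⇒m∸n≡0 (ℕP.≤-trans (ℕP.m⊓n≤m (suc n) b) (ℕP.≰⇒> a≰n)))))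

tabulate-toℕ : ∀ {b} {β : Set b} (f : ℕ → β) n → tabulate {n = n} (f ∘ toℕ) ≡ applyUpTo f n
tabulate-toℕ f zero = ≡.refl
tabulate-toℕ f (suc n) = ≡.cong (f 0 ∷_) (tabulate-toℕ (f ∘ suc) n)

block-size : ∀ N a b → b ≤ N → Σℕ.sumM (λ i → count (does (inBlock? {N} a b i))) (allFin N) ≡ b ∸ a
block-size N a b b≤N = begin
  Σℕ.sumM (f ∘ toℕ) (allFin N)          ≡⟨ ≡.cong (foldr ℕ._+_ 0) (ListP.map-tabulate {n = N} (λ i → i) (f ∘ toℕ)) ⟩
  foldr ℕ._+_ 0 (tabulate {n = N} (f ∘ toℕ)) ≡⟨ ≡.cong (foldr ℕ._+_ 0) (≡.trans (tabulate-toℕ f N) (≡.sym (ListP.map-upTo f N))) ⟩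
  Σℕ.sumM f (upTo N)                    ≡⟨ interval-count a b N ⟩
  (N ℕ.⊓ b) ∸ a                         ≡⟨ ≡.cong (_∸ a) (ℕP.m≥n⇒m⊓n≡n b≤N) ⟩
  b ∸ a                                 ∎
  where
  open ≡.≡-Reasoning
  f : ℕ → ℕ
  f m = count (does (inInterval? a b m))

module _ {N : ℕ} where
  crosses : Fin N × Fin N → Fin N × Fin N → ℕ
  crosses p p′ = if (toℕ (proj₁ p) ℕ.<ᵇ toℕ (proj₁ p′)) ∧ (toℕ (proj₁ p′) ℕ.<ᵇ toℕ (proj₂ p))
                     ∧ (toℕ (proj₂ p) ℕ.<ᵇ toℕ (proj₂ p′)) then 1 else 0

  crossings-sum : ∀ π → crossings π ≡ Σℕ.sumM (λ p → Σℕ.sumM (crosses p) π) π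
  crossings-sum π = begin
    foldr ℕ._+_ 0 (concatMap (λ p → map (crosses p) π) π)
      ≡⟨ ≡.cong (foldr ℕ._+_ 0) (ListP.map-id (concatMap (λ p → map (crosses p) π) π)) ⟨
    Σℕ.sumM (λ n → n) (concatMap (λ p → map (crosses p) π) π)
      ≡⟨ Σℕ.sum-concatMap (λ n → n) (λ p → map (crosses p) π) π ⟩
    Σℕ.sumM (λ p → Σℕ.sumM (λ n → n) (map (crosses p) π)) π
      ≡⟨ Σℕ.sum-cong π (λ p → Σℕ.sum-map (λ n → n) (crosses p) π) ⟩
    Σℕ.sumM (λ p → Σℕ.sumM (crosses p) π) π ∎
    where open ≡.≡-Reasoning

  crossings-↭ : ∀ {π π′} → π ↭ π′ → crossings π ≡ crossings π′
  crossings-↭ {π} {π′} e = begin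
    crossings π                                   ≡⟨ crossings-sum π ⟩
    Σℕ.sumM (λ p → Σℕ.sumM (crosses p) π) π      ≡⟨ Σℕ.sum-↭ _ e ⟩
    Σℕ.sumM (λ p → Σℕ.sumM (crosses p) π) π′     ≡⟨ Σℕ.sum-cong π′ (λ p → Σℕ.sum-↭ (crosses p) e) ⟩
    Σℕ.sumM (λ p → Σℕ.sumM (crosses p) π′) π′    ≡⟨ crossings-sum π′ ⟨
    crossings π′                                  ∎
    where open ≡.≡-Reasoning

  no-crossing : ∀ {p p′ : Fin N × Fin N} →
    (toℕ (proj₁ p) < toℕ (proj₁ p′) → toℕ (proj₁ p′) < toℕ (proj₂ p) → toℕ (proj₂ p) < toℕ (proj₂ p′) → ⊥) →
    crosses p p′ ≡ 0
  no-crossing {(i , k)} {(j , l)} h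
    with toℕ i ℕ.<ᵇ toℕ j | ℕP.<ᵇ⇒< (toℕ i) (toℕ j)
       | toℕ j ℕ.<ᵇ toℕ k | ℕP.<ᵇ⇒< (toℕ j) (toℕ k)
       | toℕ k ℕ.<ᵇ toℕ l | ℕP.<ᵇ⇒< (toℕ k) (toℕ l)
  ... | false | _ | _ | _ | _ | _ = ≡.refl
  ... | true | _ | false | _ | _ | _ = ≡.refl
  ... | true | _ | true | _ | false | _ = ≡.refl
  ... | true | i<j | true | j<k | true | k<l = ⊥-elim (h (i<j tt) (j<k tt) (k<l tt))

module _ {N : ℕ} (a b : ℕ) where
  Outside Inside : Fin N × Fin N → Set
  Outside p = ¬ InBlock a b (proj₁ p) × ¬ InBlock a b (proj₂ p)
  Inside p = InBlock a b (proj₁ p) × InBlock a b (proj₂ p)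

  -- As the block is an interval, a pair outside it and a pair inside it
  -- never cross; hence signs multiply over such a union of matchings.
  crossings-++ : ∀ {σ τ} → All Outside σ → All Inside τ → crossings (σ ++ τ) ≡ crossings σ ℕ.+ crossings τ
  crossings-++ {σ} {τ} outσ inτ = begin
    crossings (σ ++ τ)                                        ≡⟨ crossings-sum (σ ++ τ) ⟩
    crossSum (σ ++ τ) (σ ++ τ)                                ≡⟨ Σℕ.sum-++ _ σ τ ⟩
    crossSum σ (σ ++ τ) ℕ.+ crossSum τ (σ ++ τ)               ≡⟨ ≡.cong₂ ℕ._+_ (crossSum-++ σ) (crossSum-++ τ) ⟩
    (crossSum σ σ ℕ.+ crossSum σ τ) ℕ.+ (crossSum τ σ ℕ.+ crossSum τ τ)
      ≡⟨ ≡.cong₂ (λ u v → (crossSum σ σ ℕ.+ u) ℕ.+ (v ℕ.+ crossSum τ τ))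
           (no-crossings outside-inside outσ inτ) (no-crossings inside-outside inτ outσ) ⟩
    (crossSum σ σ ℕ.+ 0) ℕ.+ crossSum τ τ                     ≡⟨ ≡.cong₂ ℕ._+_ (ℕP.+-identityʳ _) (≡.sym (crossings-sum τ)) ⟩
    crossSum σ σ ℕ.+ crossings τ                              ≡⟨ ≡.cong (ℕ._+ crossings τ) (crossings-sum σ) ⟨
    crossings σ ℕ.+ crossings τ                               ∎
    where
    open ≡.≡-Reasoning
    crossSum : List (Fin N × Fin N) → List (Fin N × Fin N) → ℕ
    crossSum m₁ m₂ = Σℕ.sumM (λ p → Σℕ.sumM (crosses p) m₂) m₁

    crossSum-++ : ∀ m → crossSum m (σ ++ τ) ≡ crossSum m σ ℕ.+ crossSum m τ
    crossSum-++ m = ≡.trans (Σℕ.sum-cong m (λ p → Σℕ.sum-++ (crosses p) σ τ)) (Σℕ.sum-∙ _ _ m)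

    no-crossings : ∀ {Q₁ Q₂ : Fin N × Fin N → Set} → (∀ {p p′} → Q₁ p → Q₂ p′ → crosses p p′ ≡ 0) →
      ∀ {m₁ m₂} → All Q₁ m₁ → All Q₂ m₂ → crossSum m₁ m₂ ≡ 0
    no-crossings none q₁ q₂ = Σℕ.sum-zero-All (All.map (λ q → Σℕ.sum-zero-All (All.map (none q) q₂)) q₁)

    outside-inside : ∀ {p p′} → Outside p → Inside p′ → crosses p p′ ≡ 0
    outside-inside {p} {p′} (_ , k∉) ((a≤j , _) , (_ , l<b)) = no-crossing {p = p} {p′ = p′} λ _ j<k k<l →
      k∉ (ℕP.≤-trans a≤j (ℕP.<⇒≤ j<k) , ℕP.<-trans k<l l<b)

    inside-outside : ∀ {p p′} → Inside p → Outside p′ → crosses p p′ ≡ 0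
    inside-outside {p} {p′} ((a≤i , _) , (_ , k<b)) (j∉ , _) = no-crossing {p = p} {p′ = p′} λ i<j j<k _ →
      j∉ (ℕP.≤-trans a≤i (ℕP.<⇒≤ i<j) , ℕP.<-trans j<k k<b)

-- A matching π of {1..N} with E(π) pairs meeting a block of C points,
-- m(π) of them mixed, has C + m ≡ E + E.
double : ∀ n → n ℕ.+ n ≡ n ℕ.* 2
double n = ≡.trans (≡.cong (n ℕ.+_) (≡.sym (ℕP.+-identityʳ n))) (ℕP.*-comm 2 n)

half≤ : ∀ C m E → C ℕ.+ m ≡ E ℕ.+ E → C / 2 ≤ E
half≤ C m E eq = ℕP.*-cancelʳ-≤ (C / 2) E 2 (begin
  C / 2 ℕ.* 2 ≤⟨ ℕD.m/n*n≤m C 2 ⟩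
  C           ≤⟨ ℕP.m≤m+n C m ⟩
  C ℕ.+ m     ≡⟨ eq ⟩
  E ℕ.+ E     ≡⟨ double E ⟩
  E ℕ.* 2     ∎)
  where open ℕP.≤-Reasoning

excess-zero⇒unmixed : ∀ C m E → C ℕ.+ m ≡ E ℕ.+ E → E ∸ C / 2 ≡ 0 → m ≡ 0
excess-zero⇒unmixed C m E eq e = ℕP.n≤0⇒n≡0 (ℕP.+-cancelˡ-≤ C m 0 (begin
  C ℕ.+ m     ≡⟨ eq ⟩
  E ℕ.+ E     ≡⟨ double E ⟩
  E ℕ.* 2     ≤⟨ ℕP.*-monoˡ-≤ 2 (ℕP.m∸n≡0⇒m≤n {E} {C / 2} e) ⟩
  C / 2 ℕ.* 2 ≤⟨ ℕD.m/n*n≤m C 2 ⟩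
  C           ≡⟨ ℕP.+-identityʳ C ⟨
  C ℕ.+ 0     ∎))
  where open ℕP.≤-Reasoning

unmixed⇒excess-zero : ∀ C m E → C ℕ.+ m ≡ E ℕ.+ E → m ≡ 0 → E ∸ C / 2 ≡ 0
unmixed⇒excess-zero C m E eq ≡.refl = ≡.trans (≡.cong (E ∸_) half≡) (ℕP.n∸n≡0 E)
  where
  half≡ : C / 2 ≡ E
  half≡ = ≡.trans (≡.cong (_/ 2) (≡.trans (≡.sym (ℕP.+-identityʳ C)) (≡.trans eq (double E)))) (ℕD.m*n/n≡m E 2)

module Factorization {c ℓ} (R : CommutativeRing c ℓ) (N a b : ℕ) where
  open CommutativeRing R hiding (zero)
  open OverRing R
  open Polynomials R
  open RingSums R
  open Evaluation R
  private
    module PR = RingSums PolyRing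
    module PRing = CommutativeRing PolyRing
    module MSℕ = MatchingSums ℕP.+-0-commutativeMonoid {α = Fin N}
  open MatchingSums +-commutativeMonoid {α = Fin N} using (module Split)
  open Split (inBlock? {N} a b) using (¬P?; Mixed; Splittable; split-sum)

  Pair : Set
  Pair = Fin N × Fin N

  inB : Fin N → Bool
  inB i = does (inBlock? a b i)

  touches mixed : Bool → Bool → ℕ
  touches true _ = 1
  touches false v = count v
  mixed true v = count (not v)
  mixed false v = count v

  ends-mixed : ∀ u v → (count u ℕ.+ count v) ℕ.+ mixed u v ≡ touches u v ℕ.+ touches u v
  ends-mixed true true = ≡.refl
  ends-mixed true false = ≡.refl
  ends-mixed false true = ≡.refl
  ends-mixed false false = ≡.refl

  touchesP mixedP : Pair → ℕ
  touchesP p = touches (inB (proj₁ p)) (inB (proj₂ p))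
  mixedP p = mixed (inB (proj₁ p)) (inB (proj₂ p))

  touching mixedPairs : List Pair → ℕ
  touching = Σℕ.sumM touchesP
  mixedPairs = Σℕ.sumM mixedP

  -- Counting the block's points through a perfect matching of {1..N}.
  block-points : b ≤ N → All (λ π → (b ∸ a) ℕ.+ mixedPairs π ≡ touching π ℕ.+ touching π) (matchings (allFin N))
  block-points b≤N = All.map (λ {π} covers → begin
    (b ∸ a) ℕ.+ mixedPairs π
      ≡⟨ ≡.cong (ℕ._+ mixedPairs π) (≡.trans (≡.sym (block-size N a b b≤N)) (Σℕ.sum-↭ ind (↭-sym covers))) ⟩
    Σℕ.sumM ind (points π) ℕ.+ mixedPairs π
      ≡⟨ ≡.cong (ℕ._+ mixedPairs π) (MSℕ.sum-points ind π) ⟨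
    Σℕ.sumM (λ p → ind (proj₁ p) ℕ.+ ind (proj₂ p)) π ℕ.+ mixedPairs π
      ≡⟨ Σℕ.sum-∙ _ mixedP π ⟨
    Σℕ.sumM (λ p → (ind (proj₁ p) ℕ.+ ind (proj₂ p)) ℕ.+ mixedP p) π
      ≡⟨ Σℕ.sum-cong π (λ p → ends-mixed (inB (proj₁ p)) (inB (proj₂ p))) ⟩
    Σℕ.sumM (λ p → touchesP p ℕ.+ touchesP p) π
      ≡⟨ Σℕ.sum-∙ touchesP touchesP π ⟩
    touching π ℕ.+ touching π ∎) (matchingsF-points (length (allFin N)) (allFin N))
    where
    open ≡.≡-Reasoning
    ind : Fin N → ℕ
    ind i = count (inB i)

  mixed-pair : ∀ {x y} → Mixed x y → mixedP (x , y) ≡ 1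
  mixed-pair {x} {y} (inj₁ (x∈ , y∉)) = ≡.cong₂ mixed (dec-true (inBlock? a b x) x∈) (dec-false (inBlock? a b y) y∉)
  mixed-pair {x} {y} (inj₂ (x∉ , y∈)) = ≡.cong₂ mixed (dec-false (inBlock? a b x) x∉) (dec-true (inBlock? a b y) y∈)

  outside-unmixed : ∀ {p} → Outside a b p → mixedP p ≡ 0
  outside-unmixed {i , j} (i∉ , j∉) = ≡.cong₂ mixed (dec-false (inBlock? a b i) i∉) (dec-false (inBlock? a b j) j∉)

  inside-unmixed : ∀ {p} → Inside a b p → mixedP p ≡ 0
  inside-unmixed {i , j} (i∈ , j∈) = ≡.cong₂ mixed (dec-true (inBlock? a b i) i∈) (dec-true (inBlock? a b j) j∈)

  module WithEntries (s : Carrier) (A q : Fin N → Fin N → Poly)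
           (skew : ∀ i j → A j i ≈P -P (A i j))
           (divisible : ∀ i j → InBlock a b i → A i j ≈P xPlus s *P q i j) where

    X : Poly
    X = xPlus s

    reduced : Bool → Bool → Fin N → Fin N → Poly
    reduced true _ i j = q i j
    reduced false true i j = -P (q j i)
    reduced false false i j = A i j

    entry-factor : ∀ i j (di : Dec (InBlock a b i)) (dj : Dec (InBlock a b j)) →
      A i j ≋ X PR.^ (touches (does di) (does dj)) *P reduced (does di) (does dj) i j
    entry-factor i j (yes i∈) _ = P-trans (mk (divisible i j i∈)) (*P-congˡ (q i j) (P-sym (*P-identityʳ X)))
    entry-factor i j (no _) (yes j∈) = begin
      A i j         ≈⟨ mk (skew j i) ⟩
      -P A j i      ≈⟨ -P-cong (mk (divisible j i j∈)) ⟩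
      -P (X *P q j i) ≈⟨ -‿distribʳ-* X (q j i) ⟩
      X *P (-P q j i) ≈⟨ *P-congˡ (-P q j i) (P-sym (*P-identityʳ X)) ⟩
      (X *P 1P) *P (-P q j i) ∎
      where
      open import Relation.Binary.Reasoning.Setoid PRing.setoid
      open import Algebra.Properties.Ring PRing.ring using (-‿distribʳ-*)
    entry-factor i j (no _) (no _) = P-sym (*P-identityˡ (A i j))

    Ap Bp : Pair → Poly
    Ap p = A (proj₁ p) (proj₂ p)
    Bp p = reduced (inB (proj₁ p)) (inB (proj₂ p)) (proj₁ p) (proj₂ p)

    product-factor : ∀ π → PR.prodR Ap π ≋ X PR.^ touching π *P PR.prodR Bp π
    product-factor [] = P-sym (*P-identityˡ 1P)
    product-factor ((i , j) ∷ π) = begin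
      A i j *P PR.prodR Ap π
        ≈⟨ PRing.*-cong (entry-factor i j (inBlock? a b i) (inBlock? a b j)) (product-factor π) ⟩
      (X PR.^ touchesP (i , j) *P Bp (i , j)) *P (X PR.^ touching π *P PR.prodR Bp π)
        ≈⟨ interchange (X PR.^ touchesP (i , j)) (Bp (i , j)) (X PR.^ touching π) (PR.prodR Bp π) ⟩
      (X PR.^ touchesP (i , j) *P X PR.^ touching π) *P (Bp (i , j) *P PR.prodR Bp π)
        ≈⟨ PRing.*-congʳ {Bp (i , j) *P PR.prodR Bp π} (PR.^-homo-* X (touchesP (i , j)) (touching π)) ⟨
      X PR.^ touching ((i , j) ∷ π) *P PR.prodR Bp ((i , j) ∷ π) ∎
      where
      open import Relation.Binary.Reasoning.Setoid PRing.setoid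
      open import Algebra.Properties.CommutativeSemigroup PRing.*-commutativeSemigroup using (interchange)

    k : ℕ
    k = (b ∸ a) / 2

    sgnP : List Pair → Poly
    sgnP π = if isEven (crossings π) then 1P else -P 1P

    reducedTerm : List Pair → Poly
    reducedTerm π = sgnP π *P (X PR.^ (touching π ∸ k) *P PR.prodR Bp π)

    Q : Poly
    Q = PR.sumR reducedTerm (matchings (allFin N))

    term-factor : ∀ π → k ≤ touching π → sgnP π *P PR.prodR Ap π ≋ X PR.^ k *P reducedTerm π
    term-factor π k≤E = begin
      sgnP π *P PR.prodR Ap π
        ≈⟨ PRing.*-congˡ {sgnP π} (product-factor π) ⟩
      sgnP π *P (X PR.^ touching π *P PR.prodR Bp π)
        ≡⟨ ≡.cong (λ e → sgnP π *P (X PR.^ e *P PR.prodR Bp π)) (ℕP.m+[n∸m]≡n k≤E) ⟨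
      sgnP π *P (X PR.^ (k ℕ.+ (touching π ∸ k)) *P PR.prodR Bp π)
        ≈⟨ PRing.*-congˡ {sgnP π} (PRing.*-congʳ {PR.prodR Bp π} (PR.^-homo-* X k (touching π ∸ k))) ⟩
      sgnP π *P ((Xᵏ *P X PR.^ (touching π ∸ k)) *P PR.prodR Bp π)
        ≈⟨ PRing.*-congˡ {sgnP π} (PRing.*-assoc Xᵏ _ _) ⟩
      sgnP π *P (Xᵏ *P (X PR.^ (touching π ∸ k) *P PR.prodR Bp π))
        ≈⟨ x∙yz≈y∙xz (sgnP π) Xᵏ _ ⟩
      Xᵏ *P reducedTerm π ∎
      where
      open import Relation.Binary.Reasoning.Setoid PRing.setoid
      open import Algebra.Properties.CommutativeSemigroup PRing.*-commutativeSemigroup using (x∙yz≈y∙xz)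
      Xᵏ : Poly
      Xᵏ = X PR.^ k

    ^≡^P : ∀ p n → p PR.^ n ≡ p ^P n
    ^≡^P p zero = ≡.refl
    ^≡^P p (suc n) = ≡.cong (p *P_) (^≡^P p n)

    -- Pf A = (x + s)^k · Q, since every matching has k ≤ E(π).
    divisibility : b ≤ N → PfP (allFin N) A ≈P (X ^P k) *P Q
    divisibility b≤N = ≡.subst (λ Xᵏ → PfP (allFin N) A ≈P Xᵏ *P Q) (^≡^P X k) (get (begin
      PR.sumR (λ π → sgnP π *P PR.prodR Ap π) (matchings (allFin N))
        ≈⟨ PR.S+.sum-cong-All (All.map (λ {π} count-eq → term-factor π (half≤ (b ∸ a) _ _ count-eq)) (block-points b≤N)) ⟩
      PR.sumR (λ π → X PR.^ k *P reducedTerm π) (matchings (allFin N))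
        ≈⟨ PR.sum-*ˡ (X PR.^ k) reducedTerm (matchings (allFin N)) ⟨
      X PR.^ k *P Q ∎))
      where open import Relation.Binary.Reasoning.Setoid PRing.setoid

    t z : Carrier
    t = - s
    z = eval X t

    z≈0 : z ≈ 0#
    z≈0 = begin
      s + t * (1# + t * 0#) ≈⟨ +-congˡ (*-congˡ (eval-1 t)) ⟩
      s + t * 1#            ≈⟨ +-congˡ (*-identityʳ t) ⟩
      s + - s               ≈⟨ -‿inverseʳ s ⟩
      0#                    ∎
      where open import Relation.Binary.Reasoning.Setoid setoid

    eA eq eB : Pair → Carrier
    eA p = eval (Ap p) t
    eq p = eval (q (proj₁ p) (proj₂ p)) t
    eB p = eval (Bp p) t

    -- The value of Q's summand at x = −s, with (x + s)^(E−k) replaced by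
    -- 0^m; on matchings of {1..N} the two agree, and the new form splits.
    summand : List Pair → Carrier
    summand π = sign (crossings π) * (z ^ (mixedPairs π) * prodR eB π)

    eval-sgnP : ∀ π → eval (sgnP π) t ≈ sign (crossings π)
    eval-sgnP π with isEven (crossings π)
    ... | true = eval-1 t
    ... | false = trans (eval-neg 1P t) (-‿cong (eval-1 t))

    eval-reducedTerm : ∀ π → eval (reducedTerm π) t ≈ sign (crossings π) * (z ^ (touching π ∸ k) * prodR eB π)
    eval-reducedTerm π = trans (eval-* (sgnP π) _ t) (*-cong (eval-sgnP π)
      (trans (eval-* (X PR.^ (touching π ∸ k)) (PR.prodR Bp π) t)
        (*-cong (eval-pow X (touching π ∸ k) t) (eval-prod Bp π t))))

    reducedTerm-summand : b ≤ N → All (λ π → eval (reducedTerm π) t ≈ summand π) (matchings (allFin N))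
    reducedTerm-summand b≤N = All.map (λ {π} count-eq → trans (eval-reducedTerm π)
      (*-congˡ (*-congʳ (^-zero-agree z≈0 (touching π ∸ k) (mixedPairs π)
        (excess-zero⇒unmixed (b ∸ a) _ _ count-eq) (unmixed⇒excess-zero (b ∸ a) _ _ count-eq)))))
      (block-points b≤N)

    summand-splittable : Splittable summand
    summand-splittable = record
      { mixed-vanishes = λ {x} {y} m π → begin
          summand ((x , y) ∷ π)
            ≡⟨ ≡.cong (λ e → sign (crossings ((x , y) ∷ π)) * (z ^ (e ℕ.+ mixedPairs π) * prodR eB ((x , y) ∷ π))) (mixed-pair m) ⟩
          sign (crossings ((x , y) ∷ π)) * (z ^ (suc (mixedPairs π)) * prodR eB ((x , y) ∷ π))
            ≈⟨ *-congˡ (trans (*-congʳ (^-suc-vanishes z≈0 (mixedPairs π))) (zeroˡ _)) ⟩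
          sign (crossings ((x , y) ∷ π)) * 0# ≈⟨ zeroʳ _ ⟩
          0# ∎
      ; reorder = λ e → *-cong (reflexive (≡.cong sign (crossings-↭ e)))
          (*-cong (reflexive (≡.cong (z ^_) (Σℕ.sum-↭ mixedP e))) (S*.sum-↭ eB e)) }
      where open import Relation.Binary.Reasoning.Setoid setoid

    outside-reduced : ∀ {p} → Outside a b p → Bp p ≡ Ap p
    outside-reduced {i , j} (i∉ , j∉) =
      ≡.cong₂ (λ u v → reduced u v i j) (dec-false (inBlock? a b i) i∉) (dec-false (inBlock? a b j) j∉)

    inside-reduced : ∀ {p} → Inside a b p → Bp p ≡ q (proj₁ p) (proj₂ p)
    inside-reduced {i , j} (i∈ , _) = ≡.cong (λ u → reduced u (inB j) i j) (dec-true (inBlock? a b i) i∈)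

    outerTerm innerTerm : List Pair → Carrier
    outerTerm σ = sign (crossings σ) * prodR eA σ
    innerTerm τ = sign (crossings τ) * prodR eq τ

    summand-split : ∀ {σ τ} → All (Outside a b) σ → All (Inside a b) τ →
      summand (σ ++ τ) ≈ outerTerm σ * innerTerm τ
    summand-split {σ} {τ} outσ inτ = begin
      sign (crossings (σ ++ τ)) * (z ^ (mixedPairs (σ ++ τ)) * prodR eB (σ ++ τ))
        ≡⟨ ≡.cong₂ (λ c m → sign c * (z ^ m * prodR eB (σ ++ τ))) (crossings-++ a b outσ inτ) unmixed ⟩
      sign (crossings σ ℕ.+ crossings τ) * (1# * prodR eB (σ ++ τ))
        ≈⟨ *-cong (sign-+ (crossings σ) (crossings τ)) (trans (*-identityˡ _) (S*.sum-++ eB σ τ)) ⟩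
      (sign (crossings σ) * sign (crossings τ)) * (prodR eB σ * prodR eB τ)
        ≈⟨ *-congˡ (*-cong (S*.sum-cong-All (All.map (λ o → reflexive (≡.cong (λ B → eval B t) (outside-reduced o))) outσ))
                           (S*.sum-cong-All (All.map (λ i → reflexive (≡.cong (λ B → eval B t) (inside-reduced i))) inτ))) ⟩
      (sign (crossings σ) * sign (crossings τ)) * (prodR eA σ * prodR eq τ)
        ≈⟨ interchange _ _ _ _ ⟩
      outerTerm σ * innerTerm τ ∎
      where
      open import Relation.Binary.Reasoning.Setoid setoid
      open import Algebra.Properties.CommutativeSemigroup *-commutativeSemigroup using (interchange)
      unmixed : mixedPairs (σ ++ τ) ≡ 0
      unmixed = ≡.trans (Σℕ.sum-++ mixedP σ τ) (≡.cong₂ ℕ._+_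
        (Σℕ.sum-zero-All (All.map outside-unmixed outσ)) (Σℕ.sum-zero-All (All.map inside-unmixed inτ)))

    evaluation : b ≤ N → eval Q t ≈
      Pf (outsideIdx N a b) (λ i j → eval (A i j) t) * Pf (blockIdx N a b) (λ i j → eval (q i j) t)
    evaluation b≤N = begin
      eval Q t                                     ≈⟨ eval-sum reducedTerm M t ⟩
      sumR (λ π → eval (reducedTerm π) t) M        ≈⟨ S+.sum-cong-All (reducedTerm-summand b≤N) ⟩
      sumR summand M                               ≈⟨ split-sum (length (allFin N)) (allFin N) ℕP.≤-refl summand-splittable ⟩
      sumR (λ σ → sumR (λ τ → summand (σ ++ τ)) (matchings inner)) (matchings outer)
        ≈⟨ S+.sum-cong-All (All.map (λ outσ → S+.sum-cong-All (All.map (summand-split outσ)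
             (matchings-within inner (AllP.all-filter (inBlock? a b) (allFin N)))))
             (matchings-within outer (AllP.all-filter ¬P? (allFin N)))) ⟩
      sumR (λ σ → sumR (λ τ → outerTerm σ * innerTerm τ) (matchings inner)) (matchings outer)
        ≈⟨ S+.sum-cong (matchings outer) (λ σ → sum-*ˡ (outerTerm σ) innerTerm (matchings inner)) ⟨
      sumR (λ σ → outerTerm σ * sumR innerTerm (matchings inner)) (matchings outer)
        ≈⟨ sum-*ʳ (sumR innerTerm (matchings inner)) outerTerm (matchings outer) ⟨
      sumR outerTerm (matchings outer) * sumR innerTerm (matchings inner) ∎
      where
      open import Relation.Binary.Reasoning.Setoid setoid
      M : List (List Pair)
      M = matchings (allFin N)
      outer inner : List (Fin N)
      outer = filter ¬P? (allFin N)
      inner = filter (inBlock? a b) (allFin N)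

-- The theorem: Q is the quotient of divisibility, evaluated by evaluation.
lemma11 : ∀ {c ℓ : Level} (R : CommutativeRing c ℓ) →
    let open CommutativeRing R
        open OverRing R
    in (N a b : ℕ) → 0 < a → a < b → b ≤ N → 2 ∣ N → 2 ∣ (b ∸ a) →
       (s : Carrier) →
       (A : Fin N → Fin N → Poly) →
       (∀ i j → A j i ≈P -P (A i j)) →
       (∀ i → A i i ≈P 0P) →
       (q : Fin N → Fin N → Poly) →
       (∀ i j → InBlock a b i → A i j ≈P xPlus s *P q i j) →
       Σ Poly (λ Q →
         (PfP (allFin N) A ≈P (xPlus s ^P ((b ∸ a) / 2)) *P Q)
         × (eval Q (- s) ≈
             Pf (outsideIdx N a b) (λ i j → eval (A i j) (- s))
             * Pf (blockIdx N a b) (λ i j → eval (q i j) (- s))))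
lemma11 R N a b _ _ b≤N _ _ s A skew _ q divisible = Q , divisibility b≤N , evaluation b≤N
  where open Factorization.WithEntries R N a b s A q skew divisible
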